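{- Let $f:\{ -1,1\}^n\to\{ -1,1\}$. If $f$ is strongly spectral threshold (SST), then $f$ is low-correlation self-predicting (LCSP). Conversely, if $f$ is LCSP, then $f$ is weakly spectral threshold (WST).
   Context: Fourier expansion: $f(x^n)=\sum_{S\subseteq[n]}\hat f_S x^S$, $x^S=\prod_{i\in S}x_i$, $\hat f_S=\mathbb{E}[f(X^n)X^S]$ with $X^n$ uniform. $W^k[f]=\sum_{|S|=k}\hat f_S^2$. The minimal level is $\mathrm{Lev}(f)=\min\{k\in\{0,1,\dots,n\}:W^k[f]>0\}$ and $f_{\mathrm{Lev}}(x^n)=\sum_{|S|=\mathrm{Lev}(f)}\hat f_S x^S$. $f$ is WST if $f_{\mathrm{Lev}}(x^n)f(x^n)\ge0$ for all $x^n$; $f$ is SST if it is WST and $f_{\mathrm{Lev}}(x^n)\neq0$ for all $x^n$. For $\rho\in[0,1]$, $T_\rho f(y^n)=\sum_S\rho^{|S|}\hat f_S y^S$ (the conditional expectation of $f(X^n)$ given the $\rho$-correlated noisy copy $Y^n=y^n$, each coordinate flipped independently with probability $(1-\rho)/2$). $\operatorname{sgn}(0)=0$. $f$ is $\rho$-SP if $f(y^n)=\operatorname{sgn}T_\rho f(y^n)$ for all $y^n$ with $T_\rho f(y^n)\neq 0$. $f$ is LCSP if there is $\rho^*>0$ such that $f$ is $\rho$-SP for all $\rho\in[0,\rho^*)$.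
   Formalization: The correlation ρ and the threshold ρ* are rational, with ρ taken in the rational points of [0,1] rather than the real interval. -}

module Defs where

open import Data.Nat as ℕ using (ℕ; zero; suc)
open import Data.Bool using (Bool; true; false; if_then_else_)
open import Data.Sign using (Sign) renaming (+ to pos; - to neg)
open import Data.Vec using (Vec; []; _∷_)
open import Data.List using (List; []; _∷_; map; concatMap; foldr; upTo; filter)
open import Data.Fin.Subset using (Subset; ∣_∣)
open import Data.Integer as ℤ using (+_)
open import Data.Rational using (ℚ; 0ℚ; 1ℚ; _+_; _*_; -_; _/_; _<_; _≤_)
open import Data.Rational.Properties using (_<?_)
open import Relation.Nullary using (¬_; yes; no)
open import Relation.Binary.PropositionalEquality using (_≡_)
open import Data.Product using (Σ; _×_)

-- A point of {-1,1}^n: a vector of signs (pos ↦ 1, neg ↦ -1).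
Cube : ℕ → Set
Cube n = Vec Sign n

BoolFun : ℕ → Set
BoolFun n = Cube n → Sign

val : Sign → ℚ
val pos = 1ℚ
val neg = - 1ℚ

_^ℚ_ : ℚ → ℕ → ℚ
q ^ℚ zero = 1ℚ
q ^ℚ suc k = q * (q ^ℚ k)

sumℚ : List ℚ → ℚ
sumℚ = foldr _+_ 0ℚ

allPoints : (n : ℕ) → List (Cube n)
allPoints zero = [] ∷ []
allPoints (suc n) = concatMap (λ x → (pos ∷ x) ∷ (neg ∷ x) ∷ []) (allPoints n)

allSubsets : (n : ℕ) → List (Subset n)
allSubsets zero = [] ∷ []
allSubsets (suc n) = concatMap (λ S → (true ∷ S) ∷ (false ∷ S) ∷ []) (allSubsets n)

chi : ∀ {n} → Subset n → Cube n → ℚ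
chi [] [] = 1ℚ
chi (true ∷ S) (s ∷ x) = val s * chi S x
chi (false ∷ S) (s ∷ x) = chi S x

½ : ℚ
½ = (+ 1) / 2

𝔼 : ∀ n → (Cube n → ℚ) → ℚ
𝔼 n g = (½ ^ℚ n) * sumℚ (map g (allPoints n))

fhat : ∀ {n} → BoolFun n → Subset n → ℚ
fhat {n} f S = 𝔼 n (λ x → val (f x) * chi S x)

subsetsOfSize : ∀ n → ℕ → List (Subset n)
subsetsOfSize n k = filter (λ S → ∣ S ∣ ℕ.≟ k) (allSubsets n)

W : ∀ {n} → ℕ → BoolFun n → ℚ
W {n} k f = sumℚ (map (λ S → fhat f S * fhat f S) (subsetsOfSize n k))

-- minimal level: least k ∈ {0,…,n} with W^k[f] > 0
-- (the default value n is never reached for f with values in {-1,1},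
--  since Σ_k W^k[f] = 1 by Parseval)
firstPos : (ℕ → ℚ) → List ℕ → ℕ → ℕ
firstPos w [] d = d
firstPos w (k ∷ ks) d with 0ℚ <? w k
... | yes _ = k
... | no _ = firstPos w ks d

Lev : ∀ {n} → BoolFun n → ℕ
Lev {n} f = firstPos (λ k → W k f) (upTo (suc n)) n

fLev : ∀ {n} → BoolFun n → Cube n → ℚ
fLev {n} f x = sumℚ (map (λ S → fhat f S * chi S x) (subsetsOfSize n (Lev f)))

WST : ∀ {n} → BoolFun n → Set
WST {n} f = (x : Cube n) → 0ℚ ≤ fLev f x * val (f x)

SST : ∀ {n} → BoolFun n → Set
SST {n} f = WST f × ((x : Cube n) → ¬ (fLev f x ≡ 0ℚ))

T : ∀ {n} → ℚ → BoolFun n → Cube n → ℚ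
T {n} ρ f y = sumℚ (map (λ S → (ρ ^ℚ ∣ S ∣) * fhat f S * chi S y) (allSubsets n))

sgn : ℚ → ℚ
sgn q with 0ℚ <? q
... | yes _ = 1ℚ
... | no _ with q <? 0ℚ
...   | yes _ = - 1ℚ
...   | no _ = 0ℚ

SP : ∀ {n} → ℚ → BoolFun n → Set
SP {n} ρ f = (y : Cube n) → ¬ (T ρ f y ≡ 0ℚ) → val (f y) ≡ sgn (T ρ f y)

LCSP : ∀ {n} → BoolFun n → Set
LCSP {n} f = Σ ℚ λ ρ* → 0ℚ < ρ* ×
  ((ρ : ℚ) → 0ℚ ≤ ρ → ρ ≤ 1ℚ → ρ < ρ* → SP ρ f)

module Submission where

-- Fix f and a point y; write L = Lev f, A = f_Lev(y) and B = Σ_S |f̂_S y^S|.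
-- Every coefficient f̂_S with |S| < L vanishes (its square is part of the
-- zero weight W^{|S|}[f]), so in T_ρ f(y) = Σ_S ρ^{|S|} f̂_S y^S the terms
-- with |S| = L add up to ρ^L A and all others have |S| > L.  For 0 ≤ ρ ≤ 1
-- this yields the key estimate
--     |T_ρ f(y) − ρ^L A| ≤ ρ^{L+1} B,
-- so T_ρ f(y) has the sign of A as soon as ρ^L > 0 and ρ B < |A|, i.e.
-- ρ is below the radius r(y) = |A| / (B + 1), which is positive when A ≠ 0.
--   SST ⇒ LCSP: take ρ* = min_y r(y) > 0.  By WST, f(y) = sgn A; for ρ < ρ*
--     either ρ^L = 0, and then T_ρ f(y) = 0, or sgn T_ρ f(y) = sgn A.
--   LCSP ⇒ WST: where A ≠ 0 choose 0 < ρ ≤ 1 below ρ* and r(y); then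
--     f(y) = sgn T_ρ f(y) = sgn A, hence A f(y) = |A| ≥ 0.
-- The file first collects facts about order, the sign function, powers and
-- finite sums of rationals, then proves the vanishing of low coefficients,
-- the key estimate and the radius, and finally the two directions.

open import Defs
open import Data.Nat using (ℕ)
open import Data.Product using (_×_)

open import Data.Nat as ℕ using (zero; suc)
import Data.Nat.Properties as ℕP
open import Data.Bool using (if_then_else_; true; false)
open import Data.Sign using () renaming (+ to pos; - to neg)
open import Data.Vec using ([]; _∷_)
open import Data.List using (List; []; _∷_; map; filter; applyUpTo)
open import Data.List.Properties using (map-cong)
open import Data.List.Relation.Unary.All as All using (All; []; _∷_)
open import Data.List.Relation.Unary.Any using (here; there)
open import Data.List.Membership.Propositional using (_∈_)
open import Data.List.Membership.Propositional.Properties using (∈-filter⁺)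
open import Data.Fin.Subset using (Subset) renaming (∣_∣ to size)
open import Data.Rational
  using (ℚ; 0ℚ; 1ℚ; _+_; _*_; -_; _-_; _<_; _≤_; ∣_∣; _⊓_; 1/_; NonZero; Positive; positive; nonNegative; negative)
open import Data.Rational.Properties
open import Data.Rational.Solver using (module +-*-Solver)
open import Algebra.Properties.Group +-0-group using () renaming (⁻¹-involutive to neg-involutive)
open import Data.Product using (Σ; _,_; proj₁; proj₂)
open import Data.Sum using (_⊎_; inj₁; inj₂; [_,_]′)
open import Data.Empty using (⊥-elim)
open import Relation.Nullary using (¬_; Dec; yes; no; does)
open import Relation.Nullary.Decidable using (decidable-stable; toWitness)
open import Relation.Unary using (Decidable)
open import Relation.Binary.PropositionalEquality
open import Relation.Binary.Definitions using (tri<; tri≈; tri>)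
open import Data.Unit using (tt)

open +-*-Solver

0<1 : 0ℚ < 1ℚ
0<1 = toWitness {a? = 0ℚ <? 1ℚ} tt

≤⇒≯ : ∀ {p q} → p ≤ q → ¬ q < p
≤⇒≯ p≤q q<p = <-irrefl refl (<-≤-trans q<p p≤q)

nonNeg⇒pos⊎zero : ∀ {q} → 0ℚ ≤ q → 0ℚ < q ⊎ q ≡ 0ℚ
nonNeg⇒pos⊎zero {q} q≥0 with <-cmp 0ℚ q
... | tri< q>0 _ _ = inj₁ q>0
... | tri≈ _ q≡0 _ = inj₂ (sym q≡0)
... | tri> _ _ q<0 = ⊥-elim (≤⇒≯ q≥0 q<0)

⊓-pos : ∀ {p q} → 0ℚ < p → 0ℚ < q → 0ℚ < p ⊓ q
⊓-pos {p} {q} p>0 q>0 with ⊓-sel p q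
... | inj₁ p⊓q≡p = subst (0ℚ <_) (sym p⊓q≡p) p>0
... | inj₂ p⊓q≡q = subst (0ℚ <_) (sym p⊓q≡q) q>0

nonNeg-* : ∀ {p q} → 0ℚ ≤ p → 0ℚ ≤ q → 0ℚ ≤ p * q
nonNeg-* {p} {q} p≥0 q≥0 =
  nonNegative⁻¹ (p * q) {{nonNeg*nonNeg⇒nonNeg p {{nonNegative p≥0}} q {{nonNegative q≥0}}}}

pos-* : ∀ {p q} → 0ℚ < p → 0ℚ < q → 0ℚ < p * q
pos-* {p} {q} p>0 q>0 = positive⁻¹ (p * q) {{pos*pos⇒pos p {{positive p>0}} q {{positive q>0}}}}

square-pos : ∀ {q} → ¬ q ≡ 0ℚ → 0ℚ < q * q
square-pos {q} q≢0 with <-cmp q 0ℚ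
... | tri< q<0 _ _ = positive⁻¹ (q * q) {{neg*neg⇒pos q {{negative q<0}} q {{negative q<0}}}}
... | tri≈ _ q≡0 _ = ⊥-elim (q≢0 q≡0)
... | tri> _ _ q>0 = pos-* q>0 q>0

square-nonNeg : ∀ q → 0ℚ ≤ q * q
square-nonNeg q with q ≟ 0ℚ
... | yes refl = ≤-refl
... | no q≢0 = <⇒≤ (square-pos q≢0)

*-minus-one : ∀ q → q * - 1ℚ ≡ - q
*-minus-one q = trans (sym (neg-distribʳ-* q 1ℚ)) (cong -_ (*-identityʳ q))

≤-abs : ∀ x → x ≤ ∣ x ∣
≤-abs x with ∣p∣≡p∨∣p∣≡-p x
... | inj₁ ∣x∣≡x = ≤-reflexive (sym ∣x∣≡x)
... | inj₂ ∣x∣≡-x = ≤-trans x≤0 (0≤∣p∣ x)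
  where
  x≤0 : x ≤ 0ℚ
  x≤0 = subst (_≤ 0ℚ) (neg-involutive x) (neg-antimono-≤ (subst (0ℚ ≤_) ∣x∣≡-x (0≤∣p∣ x)))

-abs-≤ : ∀ x → - ∣ x ∣ ≤ x
-abs-≤ x = subst₂ _≤_ (cong -_ (∣-p∣≡∣p∣ x)) (neg-involutive x) (neg-antimono-≤ (≤-abs (- x)))

abs-neg : ∀ {p} → p < 0ℚ → ∣ p ∣ ≡ - p
abs-neg {p} p<0 = trans (sym (∣-p∣≡∣p∣ p)) (0≤p⇒∣p∣≡p (<⇒≤ (neg-antimono-< p<0)))

abs-pos : ∀ {q} → ¬ q ≡ 0ℚ → 0ℚ < ∣ q ∣
abs-pos {q} q≢0 with nonNeg⇒pos⊎zero (0≤∣p∣ q)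
... | inj₁ ∣q∣>0 = ∣q∣>0
... | inj₂ ∣q∣≡0 = ⊥-elim (q≢0 (∣p∣≡0⇒p≡0 q ∣q∣≡0))

sgn-pos : ∀ {q} → 0ℚ < q → sgn q ≡ 1ℚ
sgn-pos {q} q>0 with 0ℚ <? q
... | yes _ = refl
... | no q≯0 = ⊥-elim (q≯0 q>0)

sgn-neg : ∀ {q} → q < 0ℚ → sgn q ≡ - 1ℚ
sgn-neg {q} q<0 with 0ℚ <? q
... | yes q>0 = ⊥-elim (<-asym q>0 q<0)
... | no _ with q <? 0ℚ
...   | yes _ = refl
...   | no q≮0 = ⊥-elim (q≮0 q<0)

sgn-nonzero : ∀ {q} → ¬ q ≡ 0ℚ → ¬ sgn q ≡ 0ℚ
sgn-nonzero {q} q≢0 with <-cmp q 0ℚ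
... | tri< q<0 _ _ = λ sgn≡0 → -1≢0 (trans (sym (sgn-neg q<0)) sgn≡0)
  where
  -1≢0 : ¬ - 1ℚ ≡ 0ℚ
  -1≢0 ()
... | tri≈ _ q≡0 _ = ⊥-elim (q≢0 q≡0)
... | tri> _ _ q>0 = λ sgn≡0 → 1≢0 (trans (sym (sgn-pos q>0)) sgn≡0)

sgn-scale : ∀ {c} q → 0ℚ < c → sgn (c * q) ≡ sgn q
sgn-scale {c} q c>0 with <-cmp q 0ℚ
... | tri< q<0 _ _ = trans (sgn-neg cq<0) (sym (sgn-neg q<0))
  where
  cq<0 : c * q < 0ℚ
  cq<0 = negative⁻¹ (c * q) {{pos*neg⇒neg c {{positive c>0}} q {{negative q<0}}}}
... | tri≈ _ refl _ = cong sgn (*-zeroʳ c)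
... | tri> _ _ q>0 = trans (sgn-pos (pos-* c>0 q>0)) (sym (sgn-pos q>0))

sgn-stable : ∀ {t p} → ∣ t - p ∣ < ∣ p ∣ → sgn t ≡ sgn p
sgn-stable {t} {p} close with <-cmp p 0ℚ
... | tri< p<0 _ _ = trans (sgn-neg t<0) (sym (sgn-neg p<0))
  where
  open ≤-Reasoning
  t<0 : t < 0ℚ
  t<0 = begin-strict
    t             ≡⟨ solve 2 (λ t p → t := p :+ (t :- p)) refl t p ⟩
    p + (t - p)   ≤⟨ +-monoʳ-≤ p (≤-abs (t - p)) ⟩
    p + ∣ t - p ∣ <⟨ +-monoʳ-< p (subst (∣ t - p ∣ <_) (abs-neg p<0) close) ⟩
    p - p         ≡⟨ +-inverseʳ p ⟩
    0ℚ            ∎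
... | tri≈ _ refl _ = ⊥-elim (≤⇒≯ (0≤∣p∣ (t - 0ℚ)) close)
... | tri> _ _ p>0 = trans (sgn-pos t>0) (sym (sgn-pos p>0))
  where
  open ≤-Reasoning
  t>0 : 0ℚ < t
  t>0 = begin-strict
    0ℚ            ≡⟨ sym (+-inverseʳ p) ⟩
    p - p         <⟨ +-monoʳ-< p (neg-antimono-< (subst (∣ t - p ∣ <_) (0≤p⇒∣p∣≡p (<⇒≤ p>0)) close)) ⟩
    p - ∣ t - p ∣ ≤⟨ +-monoʳ-≤ p (-abs-≤ (t - p)) ⟩
    p + (t - p)   ≡⟨ solve 2 (λ t p → p :+ (t :- p) := t) refl t p ⟩
    t             ∎

val-sgn : ∀ {A} s → ¬ A ≡ 0ℚ → 0ℚ ≤ A * val s → val s ≡ sgn A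
val-sgn {A} pos A≢0 agree with <-cmp A 0ℚ
... | tri< A<0 _ _ = ⊥-elim (≤⇒≯ agree (subst (_< 0ℚ) (sym (*-identityʳ A)) A<0))
... | tri≈ _ A≡0 _ = ⊥-elim (A≢0 A≡0)
... | tri> _ _ A>0 = sym (sgn-pos A>0)
val-sgn {A} neg A≢0 agree with <-cmp A 0ℚ
... | tri< A<0 _ _ = sym (sgn-neg A<0)
... | tri≈ _ A≡0 _ = ⊥-elim (A≢0 A≡0)
... | tri> _ _ A>0 = ⊥-elim (≤⇒≯ agree (subst (_< 0ℚ) (sym (*-minus-one A)) (neg-antimono-< A>0)))

*-sgn-nonNeg : ∀ q → 0ℚ ≤ q * sgn q
*-sgn-nonNeg q with <-cmp q 0ℚ
... | tri< q<0 _ _ = subst (λ s → 0ℚ ≤ q * s) (sym (sgn-neg q<0))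
                       (subst (0ℚ ≤_) (sym (*-minus-one q)) (<⇒≤ (neg-antimono-< q<0)))
... | tri≈ _ refl _ = ≤-refl
... | tri> _ _ q>0 = subst (λ s → 0ℚ ≤ q * s) (sym (sgn-pos q>0))
                       (subst (0ℚ ≤_) (sym (*-identityʳ q)) (<⇒≤ q>0))

sign-agreement⇒nonNeg : ∀ A s → (¬ A ≡ 0ℚ → val s ≡ sgn A) → 0ℚ ≤ A * val s
sign-agreement⇒nonNeg A s agree with A ≟ 0ℚ
... | yes refl = ≤-reflexive (sym (*-zeroˡ (val s)))
... | no A≢0 = subst (λ v → 0ℚ ≤ A * v) (sym (agree A≢0)) (*-sgn-nonNeg A)

pow-nonNeg : ∀ {ρ} k → 0ℚ ≤ ρ → 0ℚ ≤ ρ ^ℚ k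
pow-nonNeg zero ρ≥0 = <⇒≤ 0<1
pow-nonNeg (suc k) ρ≥0 = nonNeg-* ρ≥0 (pow-nonNeg k ρ≥0)

pow-pos : ∀ {ρ} k → 0ℚ < ρ → 0ℚ < ρ ^ℚ k
pow-pos zero ρ>0 = 0<1
pow-pos (suc k) ρ>0 = pos-* ρ>0 (pow-pos k ρ>0)

pow-antitone : ∀ {ρ m k} → 0ℚ ≤ ρ → ρ ≤ 1ℚ → m ℕ.≤′ k → ρ ^ℚ k ≤ ρ ^ℚ m
pow-antitone ρ≥0 ρ≤1 ℕ.≤′-refl = ≤-refl
pow-antitone {ρ} ρ≥0 ρ≤1 (ℕ.≤′-step {k} m≤k) =
  ≤-trans (≤-trans (*-monoʳ-≤-nonNeg (ρ ^ℚ k) {{nonNegative (pow-nonNeg k ρ≥0)}} ρ≤1)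
                   (≤-reflexive (*-identityˡ (ρ ^ℚ k))))
          (pow-antitone ρ≥0 ρ≤1 m≤k)

module _ {X : Set} where

  sum-nonNeg : (g : X → ℚ) → (∀ x → 0ℚ ≤ g x) → ∀ xs → 0ℚ ≤ sumℚ (map g xs)
  sum-nonNeg g g≥0 [] = ≤-refl
  sum-nonNeg g g≥0 (x ∷ xs) = +-mono-≤ (g≥0 x) (sum-nonNeg g g≥0 xs)

  sum-pos : (g : X → ℚ) → (∀ x → 0ℚ ≤ g x) → ∀ {x xs} → x ∈ xs → 0ℚ < g x → 0ℚ < sumℚ (map g xs)
  sum-pos g g≥0 {xs = _ ∷ xs} (here refl) gx>0 = +-mono-<-≤ gx>0 (sum-nonNeg g g≥0 xs)
  sum-pos g g≥0 {xs = y ∷ _} (there x∈xs) gx>0 = +-mono-≤-< (g≥0 y) (sum-pos g g≥0 x∈xs gx>0)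

  *-sum : ∀ c (g : X → ℚ) xs → c * sumℚ (map g xs) ≡ sumℚ (map (λ x → c * g x) xs)
  *-sum c g [] = *-zeroʳ c
  *-sum c g (x ∷ xs) = trans (*-distribˡ-+ c (g x) _) (cong (c * g x +_) (*-sum c g xs))

  *-sum-filter : ∀ c (g : X → ℚ) {P : X → Set} (P? : Decidable P) xs →
                 c * sumℚ (map g (filter P? xs)) ≡ sumℚ (map (λ x → if does (P? x) then c * g x else 0ℚ) xs)
  *-sum-filter c g P? [] = *-zeroʳ c
  *-sum-filter c g P? (x ∷ xs) with does (P? x)
  ... | true = trans (*-distribˡ-+ c (g x) _) (cong (c * g x +_) (*-sum-filter c g P? xs))
  ... | false = trans (*-sum-filter c g P? xs) (sym (+-identityˡ _))

  sum-approx : ∀ (u v e : X → ℚ) xs → All (λ x → ∣ u x - v x ∣ ≤ e x) xs →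
               ∣ sumℚ (map u xs) - sumℚ (map v xs) ∣ ≤ sumℚ (map e xs)
  sum-approx u v e [] [] = ≤-refl
  sum-approx u v e (x ∷ xs) (close ∷ rest) = begin
    ∣ (u x + U) - (v x + V) ∣     ≡⟨ cong ∣_∣ (solve 4 (λ u U v V → (u :+ U) :- (v :+ V) := (u :- v) :+ (U :- V))
                                                 refl (u x) U (v x) V) ⟩
    ∣ (u x - v x) + (U - V) ∣     ≤⟨ ∣p+q∣≤∣p∣+∣q∣ (u x - v x) (U - V) ⟩
    ∣ u x - v x ∣ + ∣ U - V ∣     ≤⟨ +-mono-≤ close (sum-approx u v e xs rest) ⟩
    e x + sumℚ (map e xs)         ∎
    where
    open ≤-Reasoning
    U V : ℚ
    U = sumℚ (map u xs)
    V = sumℚ (map v xs)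

firstPos-skips : (w : ℕ → ℚ) (d : ℕ) → ∀ m j (g : ℕ → ℕ) → (∀ i → g i ≡ j ℕ.+ i) →
                 ∀ {k} → j ℕ.≤ k → k ℕ.< firstPos w (applyUpTo g m) d → d ℕ.≤ j ℕ.+ m → ¬ 0ℚ < w k
firstPos-skips w d zero j g g≡ j≤k k<d d≤j+0 =
  ⊥-elim (ℕP.<⇒≱ k<d (ℕP.≤-trans d≤j+0 (ℕP.≤-trans (ℕP.≤-reflexive (ℕP.+-identityʳ j)) j≤k)))
firstPos-skips w d (suc m) j g g≡ j≤k k<first d≤end with 0ℚ <? w (g zero)
... | yes _ = ⊥-elim (ℕP.<⇒≱ k<first (ℕP.≤-trans (ℕP.≤-reflexive g0≡j) j≤k))
  where
  g0≡j : g zero ≡ j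
  g0≡j = trans (g≡ zero) (ℕP.+-identityʳ j)
... | no w≯0 with ℕP.m≤n⇒m<n∨m≡n j≤k
...   | inj₂ refl = subst (λ i → ¬ 0ℚ < w i) (trans (g≡ zero) (ℕP.+-identityʳ j)) w≯0
...   | inj₁ j<k = firstPos-skips w d m (suc j) (λ i → g (suc i)) (λ i → trans (g≡ (suc i)) (ℕP.+-suc j i))
                     j<k k<first (ℕP.≤-trans d≤end (ℕP.≤-reflexive (ℕP.+-suc j m)))

below-Lev-weight : ∀ {n} (f : BoolFun n) {k} → k ℕ.< Lev f → ¬ 0ℚ < W k f
below-Lev-weight {n} f k<Lev =
  firstPos-skips (λ k → W k f) n (suc n) 0 (λ i → i) (λ i → refl) ℕ.z≤n k<Lev (ℕP.n≤1+n n)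

-- Fourier coefficients below the minimal level vanish: a nonzero f̂_S with
-- |S| < Lev f would make the weight W^{|S|}[f] positive.
low-coefficients-vanish : ∀ {n} (f : BoolFun n) → All (λ S → size S ℕ.< Lev f → fhat f S ≡ 0ℚ) (allSubsets n)
low-coefficients-vanish {n} f = All.tabulate λ {S} S∈ |S|<L →
  decidable-stable (fhat f S ≟ 0ℚ) λ f̂≢0 →
    below-Lev-weight f |S|<L
      (sum-pos (λ R → fhat f R * fhat f R) (λ R → square-nonNeg (fhat f R))
               (∈-filter⁺ (λ R → size R ℕ.≟ size S) S∈ refl) (square-pos f̂≢0))

-- A term ρ^d a of the noise expansion against its share of ρ^L f_Lev: equal
-- when d = L, both zero when d < L, and at most ρ^{L+1} |a| when d > L.
-- (The share is selected by an arbitrary decision of d ≡ L.)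
leading-term-error : ∀ {ρ} d L a (d≟L : Dec (d ≡ L)) → 0ℚ ≤ ρ → ρ ≤ 1ℚ → (d ℕ.< L → a ≡ 0ℚ) →
  ∣ ρ ^ℚ d * a - (if does d≟L then ρ ^ℚ L * a else 0ℚ) ∣ ≤ ρ ^ℚ suc L * ∣ a ∣
leading-term-error {ρ} d L a (yes refl) ρ≥0 ρ≤1 vanish = ≤-trans (≤-reflexive (cong ∣_∣ (+-inverseʳ (ρ ^ℚ d * a))))
                         (nonNeg-* (pow-nonNeg (suc d) ρ≥0) (0≤∣p∣ a))
leading-term-error {ρ} d L a (no d≢L) ρ≥0 ρ≤1 vanish with ℕP.<-cmp d L
... | tri< d<L _ _ rewrite vanish d<L | *-zeroʳ (ρ ^ℚ d) | *-zeroʳ (ρ ^ℚ suc L) = ≤-refl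
... | tri≈ _ d≡L _ = ⊥-elim (d≢L d≡L)
... | tri> _ _ d>L = begin
  ∣ ρ ^ℚ d * a - 0ℚ ∣     ≡⟨ cong ∣_∣ (+-identityʳ (ρ ^ℚ d * a)) ⟩
  ∣ ρ ^ℚ d * a ∣          ≡⟨ ∣p*q∣≡∣p∣*∣q∣ (ρ ^ℚ d) a ⟩
  ∣ ρ ^ℚ d ∣ * ∣ a ∣      ≡⟨ cong (_* ∣ a ∣) (0≤p⇒∣p∣≡p (pow-nonNeg d ρ≥0)) ⟩
  ρ ^ℚ d * ∣ a ∣          ≤⟨ *-monoʳ-≤-nonNeg ∣ a ∣ {{∣-∣-nonNeg a}} (pow-antitone ρ≥0 ρ≤1 (ℕP.≤⇒≤′ d>L)) ⟩
  ρ ^ℚ suc L * ∣ a ∣      ∎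
  where open ≤-Reasoning

absWeight : ∀ {n} → BoolFun n → Cube n → ℚ
absWeight {n} f y = sumℚ (map (λ S → ∣ fhat f S * chi S y ∣) (allSubsets n))

absWeight-nonNeg : ∀ {n} (f : BoolFun n) y → 0ℚ ≤ absWeight f y
absWeight-nonNeg {n} f y = sum-nonNeg _ (λ S → 0≤∣p∣ (fhat f S * chi S y)) (allSubsets n)

noise-approx : ∀ {n} (f : BoolFun n) y {ρ} → 0ℚ ≤ ρ → ρ ≤ 1ℚ →
  ∣ T ρ f y - ρ ^ℚ Lev f * fLev f y ∣ ≤ ρ ^ℚ suc (Lev f) * absWeight f y
noise-approx {n} f y {ρ} ρ≥0 ρ≤1 = begin
  ∣ T ρ f y - ρ ^ℚ L * fLev f y ∣
    ≡⟨ cong₂ (λ t l → ∣ t - l ∣) T-as-sum (*-sum-filter (ρ ^ℚ L) a (λ S → size S ℕ.≟ L) Ss) ⟩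
  ∣ sumℚ (map noisy Ss) - sumℚ (map leading Ss) ∣
    ≤⟨ sum-approx noisy leading error Ss (All.map (λ {S} → termwise {S}) (low-coefficients-vanish f)) ⟩
  sumℚ (map error Ss)
    ≡⟨ sym (*-sum (ρ ^ℚ suc L) (λ S → ∣ a S ∣) Ss) ⟩
  ρ ^ℚ suc L * absWeight f y ∎
  where
  open ≤-Reasoning
  L : ℕ
  L = Lev f
  Ss : List (Subset n)
  Ss = allSubsets n
  a noisy leading error : Subset n → ℚ
  a S = fhat f S * chi S y
  noisy S = ρ ^ℚ size S * a S
  leading S = if does (size S ℕ.≟ L) then ρ ^ℚ L * a S else 0ℚ
  error S = ρ ^ℚ suc L * ∣ a S ∣
  T-as-sum : T ρ f y ≡ sumℚ (map noisy Ss)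
  T-as-sum = cong sumℚ (map-cong (λ S → *-assoc (ρ ^ℚ size S) (fhat f S) (chi S y)) Ss)
  termwise : ∀ {S} → (size S ℕ.< L → fhat f S ≡ 0ℚ) → ∣ noisy S - leading S ∣ ≤ error S
  termwise {S} low = leading-term-error (size S) L (a S) (size S ℕ.≟ L) ρ≥0 ρ≤1
                       (λ |S|<L → trans (cong (_* chi S y) (low |S|<L)) (*-zeroˡ (chi S y)))

threshold : ∀ A B → 0ℚ ≤ B → Σ ℚ λ r → (0ℚ < A → 0ℚ < r) × (∀ {ρ} → 0ℚ ≤ ρ → ρ < r → ρ * B < A)
threshold A B B≥0 = A * 1/ C , (λ A>0 → pos-* A>0 (positive⁻¹ (1/ C) {{1/pos⇒pos C}})) , bound
  where
  C : ℚ
  C = B + 1ℚ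
  instance
    C-pos : Positive C
    C-pos = positive (+-mono-≤-< B≥0 0<1)
    C-nonZero : NonZero C
    C-nonZero = pos⇒nonZero C
  bound : ∀ {ρ} → 0ℚ ≤ ρ → ρ < A * 1/ C → ρ * B < A
  bound {ρ} ρ≥0 ρ<r = begin-strict
    ρ * B           ≤⟨ *-monoˡ-≤-nonNeg ρ {{nonNegative ρ≥0}} (subst (_≤ C) (+-identityʳ B) (+-monoʳ-≤ B (<⇒≤ 0<1))) ⟩
    ρ * C           <⟨ *-monoˡ-<-pos C ρ<r ⟩
    A * 1/ C * C    ≡⟨ trans (*-assoc A (1/ C) C) (trans (cong (A *_) (*-inverseˡ C)) (*-identityʳ A)) ⟩
    A               ∎
    where open ≤-Reasoning

minCube : ∀ n → (Cube n → ℚ) → ℚ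
minCube zero g = g []
minCube (suc n) g = minCube n (λ x → g (pos ∷ x)) ⊓ minCube n (λ x → g (neg ∷ x))

minCube-≤ : ∀ n g (y : Cube n) → minCube n g ≤ g y
minCube-≤ zero g [] = ≤-refl
minCube-≤ (suc n) g (pos ∷ y) = ≤-trans (p⊓q≤p _ _) (minCube-≤ n (λ x → g (pos ∷ x)) y)
minCube-≤ (suc n) g (neg ∷ y) = ≤-trans (p⊓q≤q (minCube n (λ x → g (pos ∷ x))) _) (minCube-≤ n (λ x → g (neg ∷ x)) y)

minCube-pos : ∀ n g → (∀ y → 0ℚ < g y) → 0ℚ < minCube n g
minCube-pos zero g g>0 = g>0 []
minCube-pos (suc n) g g>0 = ⊓-pos (minCube-pos n _ (λ y → g>0 (pos ∷ y))) (minCube-pos n _ (λ y → g>0 (neg ∷ y)))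

small-correlation : ∀ a b → 0ℚ < a → 0ℚ < b → Σ ℚ λ ρ → 0ℚ < ρ × ρ ≤ 1ℚ × ρ < a × ρ < b
small-correlation a b a>0 b>0 with <-dense (⊓-pos a>0 (⊓-pos b>0 0<1))
... | ρ , ρ>0 , ρ<m = ρ , ρ>0 , <⇒≤ (<-≤-trans ρ<m (≤-trans (p⊓q≤q a _) (p⊓q≤q b 1ℚ)))
                    , <-≤-trans ρ<m (p⊓q≤p a _) , <-≤-trans ρ<m (≤-trans (p⊓q≤q a _) (p⊓q≤p b 1ℚ))

module _ {n : ℕ} (f : BoolFun n) where

  -- r(y): below this correlation the level-Lev f term dominates T_ρ f(y).
  radius : Cube n → ℚ
  radius y = proj₁ (threshold ∣ fLev f y ∣ (absWeight f y) (absWeight-nonNeg f y))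

  radius-pos : ∀ y → ¬ fLev f y ≡ 0ℚ → 0ℚ < radius y
  radius-pos y A≢0 = proj₁ (proj₂ (threshold ∣ fLev f y ∣ (absWeight f y) (absWeight-nonNeg f y))) (abs-pos A≢0)

  radius-bound : ∀ y {ρ} → 0ℚ ≤ ρ → ρ < radius y → ρ * absWeight f y < ∣ fLev f y ∣
  radius-bound y = proj₂ (proj₂ (threshold ∣ fLev f y ∣ (absWeight f y) (absWeight-nonNeg f y)))

  sign-agreement : ∀ y {ρ} → 0ℚ ≤ ρ → ρ ≤ 1ℚ → 0ℚ < ρ ^ℚ Lev f → ρ < radius y →
                   sgn (T ρ f y) ≡ sgn (fLev f y)
  sign-agreement y {ρ} ρ≥0 ρ≤1 P>0 ρ<r = trans (sgn-stable {T ρ f y} {P * A} close) (sgn-scale A P>0)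
    where
    open ≤-Reasoning
    P A B : ℚ
    P = ρ ^ℚ Lev f
    A = fLev f y
    B = absWeight f y
    close : ∣ T ρ f y - P * A ∣ < ∣ P * A ∣
    close = begin-strict
      ∣ T ρ f y - P * A ∣ ≤⟨ noise-approx f y ρ≥0 ρ≤1 ⟩
      ρ * P * B           ≡⟨ solve 3 (λ ρ P B → ρ :* P :* B := P :* (ρ :* B)) refl ρ P B ⟩
      P * (ρ * B)         <⟨ *-monoʳ-<-pos P {{positive P>0}} (radius-bound y ρ≥0 ρ<r) ⟩
      P * ∣ A ∣           ≡⟨ sym (trans (∣p*q∣≡∣p∣*∣q∣ P A) (cong (_* ∣ A ∣) (0≤p⇒∣p∣≡p (<⇒≤ P>0)))) ⟩
      ∣ P * A ∣           ∎

  T-vanishes : ∀ y {ρ} → 0ℚ ≤ ρ → ρ ≤ 1ℚ → ρ ^ℚ Lev f ≡ 0ℚ → T ρ f y ≡ 0ℚ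
  T-vanishes y {ρ} ρ≥0 ρ≤1 P≡0 = ∣p∣≡0⇒p≡0 _ (≤-antisym ∣T∣≤0 (0≤∣p∣ _))
    where
    open ≤-Reasoning
    P*A≡0 : ρ ^ℚ Lev f * fLev f y ≡ 0ℚ
    P*A≡0 = trans (cong (_* fLev f y) P≡0) (*-zeroˡ (fLev f y))
    ∣T∣≤0 : ∣ T ρ f y ∣ ≤ 0ℚ
    ∣T∣≤0 = begin
      ∣ T ρ f y ∣                          ≡⟨ cong ∣_∣ (sym (+-identityʳ (T ρ f y))) ⟩
      ∣ T ρ f y - 0ℚ ∣                     ≡⟨ cong (λ z → ∣ T ρ f y - z ∣) (sym P*A≡0) ⟩
      ∣ T ρ f y - ρ ^ℚ Lev f * fLev f y ∣  ≤⟨ noise-approx f y ρ≥0 ρ≤1 ⟩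
      ρ * ρ ^ℚ Lev f * absWeight f y       ≡⟨ cong (λ z → ρ * z * absWeight f y) P≡0 ⟩
      ρ * 0ℚ * absWeight f y               ≡⟨ trans (cong (_* absWeight f y) (*-zeroʳ ρ)) (*-zeroˡ (absWeight f y)) ⟩
      0ℚ                                   ∎

  -- SST ⇒ LCSP, with ρ* the minimal radius over the cube: for ρ < ρ* either
  -- ρ^L = 0 and T_ρ f vanishes, or T_ρ f(y) has the sign of f_Lev(y), which is f(y).
  sst⇒lcsp : SST f → LCSP f
  sst⇒lcsp (wst , nonvanishing) =
    minCube n radius , minCube-pos n radius (λ y → radius-pos y (nonvanishing y)) , self-predicting
    where
    self-predicting : ∀ ρ → 0ℚ ≤ ρ → ρ ≤ 1ℚ → ρ < minCube n radius → SP ρ f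
    self-predicting ρ ρ≥0 ρ≤1 ρ<ρ* y T≢0 =
      [ (λ P>0 → trans (val-sgn (f y) (nonvanishing y) (wst y))
                       (sym (sign-agreement y ρ≥0 ρ≤1 P>0 (<-≤-trans ρ<ρ* (minCube-≤ n radius y)))))
      , (λ P≡0 → ⊥-elim (T≢0 (T-vanishes y ρ≥0 ρ≤1 P≡0)))
      ]′ (nonNeg⇒pos⊎zero (pow-nonNeg (Lev f) ρ≥0))

  -- Under LCSP, f(y) = sgn f_Lev(y) wherever f_Lev(y) ≠ 0: a small admissible ρ
  -- below r(y) makes T_ρ f(y) nonzero with the sign of f_Lev(y).
  lcsp-forces-sign : LCSP f → ∀ y → ¬ fLev f y ≡ 0ℚ → val (f y) ≡ sgn (fLev f y)
  lcsp-forces-sign (ρ* , ρ*>0 , sp) y A≢0 =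
    let (ρ , ρ>0 , ρ≤1 , ρ<ρ* , ρ<r) = small-correlation ρ* (radius y) ρ*>0 (radius-pos y A≢0)
        agree = sign-agreement y (<⇒≤ ρ>0) ρ≤1 (pow-pos (Lev f) ρ>0) ρ<r
        T≢0 = λ T≡0 → sgn-nonzero A≢0 (trans (sym agree) (cong sgn T≡0))
    in trans (sp ρ (<⇒≤ ρ>0) ρ≤1 ρ<ρ* y T≢0) agree

  lcsp⇒wst : LCSP f → WST f
  lcsp⇒wst lcsp y = sign-agreement⇒nonNeg (fLev f y) (f y) (lcsp-forces-sign lcsp y)

proposition5p1 : (n : ℕ) (f : BoolFun n) → (SST f → LCSP f) × (LCSP f → WST f)
proposition5p1 n f = sst⇒lcsp f , lcsp⇒wst f
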